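{- Let $\mathbb{K}=(G,M,I)$ be a finite formal context, $a\notin M$ a new attribute with extent $a'\subseteq G$, and $\mathbb{K}_a=(G,M\cup\{a\},I\cup\{(g,a)\mid g\in a'\})$. Set $$\mathcal{H}(a):=\{A\cap a'\mid A\in \mathrm{Ext}(\mathbb{K})\text{ and } A\cap a'\notin\mathrm{Ext}(\mathbb{K})\},\qquad h(a):=|\mathcal{H}(a)|.$$ Then: 1. $|\mathfrak{B}(\mathbb{K}_a)|-|\mathfrak{B}(\mathbb{K})|=h(a)\le |\mathfrak{B}(\mathbb{K})|$. 2. The maximal possible value $h(a)=|\mathfrak{B}(\mathbb{K})|$ is reached if every $A\in\mathrm{Ext}(\mathbb{K})$ satisfies $A\cap a'\notin\mathrm{Ext}(\mathbb{K})$ and no two distinct extents $A_1\neq A_2$ of $\mathbb{K}$ satisfy $A_1\cap a'=A_2\cap a'$.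
   Context: A formal context $(G,M,I)$ consists of a set $G$ of objects, a set $M$ of attributes and a relation $I\subseteq G\times M$. For $A\subseteq G$, $A'$ is the set of attributes shared by all objects of $A$; for $B\subseteq M$, $B'$ is the set of objects having all attributes of $B$; $m'=\{m\}'$. A concept is a pair $(A,B)$ with $A'=B$, $B'=A$. $\mathfrak{B}(\mathbb{K})$ is the set of concepts of $\mathbb{K}$ and $\mathrm{Ext}(\mathbb{K})$ the set of its extents (subsets $A\subseteq G$ with $A''=A$). -}

module Defs where

open import Data.Nat using (ℕ; zero; suc)
open import Data.Bool using (Bool; true; false; not; _∧_; _∨_)
import Data.Bool as Bool
open import Data.Fin using (Fin; zero; suc)
open import Data.Fin.Subset using (Subset; _∩_)
open import Data.Vec using (Vec; []; _∷_; lookup; tabulate)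
open import Data.Vec.Properties using (≡-dec)
open import Data.List using (List; []; _∷_; _++_; map; filter; length; deduplicate; cartesianProduct)
open import Data.Product using (_×_; _,_; proj₁)
open import Relation.Nullary using (¬_; Dec; ¬?)
open import Relation.Nullary.Decidable using (_×-dec_)
open import Relation.Binary.PropositionalEquality using (_≡_)

-- A finite formal context (G, M, I) with G = Fin n, M = Fin m;
-- I g j = true  iff  (g , j) ∈ I.
Context : ℕ → ℕ → Set
Context n m = Fin n → Fin m → Bool

allFin : ∀ {n} → (Fin n → Bool) → Bool
allFin {zero}  p = true
allFin {suc n} p = p zero ∧ allFin (λ i → p (suc i))

_↑ : ∀ {n m} {K : Context n m} → Subset n → Subset m
_↑ {K = K} A = tabulate (λ j → allFin (λ g → not (lookup A g) ∨ K g j))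

_↓ : ∀ {n m} {K : Context n m} → Subset m → Subset n
_↓ {K = K} B = tabulate (λ g → allFin (λ j → not (lookup B j) ∨ K g j))

up : ∀ {n m} (K : Context n m) → Subset n → Subset m
up K A = _↑ {K = K} A

down : ∀ {n m} (K : Context n m) → Subset m → Subset n
down K B = _↓ {K = K} B

IsConcept : ∀ {n m} (K : Context n m) → Subset n × Subset m → Set
IsConcept K (A , B) = up K A ≡ B × down K B ≡ A

IsExtent : ∀ {n m} (K : Context n m) → Subset n → Set
IsExtent K A = down K (up K A) ≡ A

_≟ˢ_ : ∀ {n} (A B : Subset n) → Dec (A ≡ B)
_≟ˢ_ = ≡-dec Bool._≟_

isConcept? : ∀ {n m} (K : Context n m) → (p : Subset n × Subset m) → Dec (IsConcept K p)
isConcept? K (A , B) = (up K A ≟ˢ B) ×-dec (down K B ≟ˢ A)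

isExtent? : ∀ {n m} (K : Context n m) → (A : Subset n) → Dec (IsExtent K A)
isExtent? K A = down K (up K A) ≟ˢ A

allSubsets : (n : ℕ) → List (Subset n)
allSubsets zero    = [] ∷ []
allSubsets (suc n) = map (true ∷_) (allSubsets n) ++ map (false ∷_) (allSubsets n)

concepts : ∀ {n m} (K : Context n m) → List (Subset n × Subset m)
concepts {n} {m} K = filter (isConcept? K) (cartesianProduct (allSubsets n) (allSubsets m))

numConcepts : ∀ {n m} (K : Context n m) → ℕ
numConcepts K = length (concepts K)

extents : ∀ {n m} (K : Context n m) → List (Subset n)
extents {n} K = filter (isExtent? K) (allSubsets n)

-- K_a = (G, M ∪ {a}, I ∪ {(g,a) | g ∈ a'}) : the new attribute a is
-- `zero : Fin (suc m)`, the old attribute j ∈ M is `suc j`.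
extend : ∀ {n m} (K : Context n m) → Subset n → Context n (suc m)
extend K a' g zero    = lookup a' g
extend K a' g (suc j) = K g j

𝓗 : ∀ {n m} (K : Context n m) → Subset n → List (Subset n)
𝓗 K a' = deduplicate _≟ˢ_ (filter (λ S → ¬? (isExtent? K S)) (map (_∩ a') (extents K)))

h : ∀ {n m} (K : Context n m) → Subset n → ℕ
h K a' = length (𝓗 K a')

module Submission where

-- Concepts correspond bijectively to extents (A ↦ (A , A')), so |𝔅(K)| is the
-- number of extents.  Writing S'' for the closure of S ⊆ G, the closure in the
-- extended context Kₐ is described by
--     g ∈ S''ₐ  ⇔  g ∈ S''  and  (S ⊆ a' → g ∈ a').
-- From this we obtain three facts about extents:
--   (i)   every extent of K is an extent of Kₐ;
--   (ii)  A ∩ a' is an extent of Kₐ for every extent A of K;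
--   (iii) an extent S of Kₐ that is not an extent of K satisfies S = S'' ∩ a'.
-- By (ii) and (iii) the extents of Kₐ that are not extents of K are exactly the
-- elements of 𝓗(a); with (i) this gives |Ext(Kₐ)| = |Ext(K)| + h(a).  The bound
-- h(a) ≤ |Ext(K)| holds because 𝓗(a) is extracted from the image of Ext(K)
-- under · ∩ a'; under the hypotheses of part 2 it is that whole image, which
-- then has no repetitions, so h(a) = |Ext(K)|.

open import Defs
open import Data.Nat using (zero; suc; _+_; _≤_)
open import Data.Nat.Properties using (+-suc; module ≤-Reasoning)
open import Data.Bool using (Bool; true; false; not; _∨_)
open import Data.Bool.Properties using (∧-conicalˡ; ∧-conicalʳ)
open import Data.Fin using (Fin; zero; suc)
open import Data.Fin.Subset using (Subset; _∩_; _⊆_) renaming (_∈_ to _∈ˢ_)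
open import Data.Fin.Subset.Properties using (⊆-antisym; _⊆?_; p∩q⊆p; p∩q⊆q; x∈p∩q⁺)
open import Data.Vec using ([]; _∷_; tabulate; lookup)
open import Data.Vec.Properties using (∷-injectiveʳ; lookup∘tabulate; []=⇒lookup; lookup⇒[]=)
open import Data.List using (List; []; _∷_; map; filter; length; cartesianProduct)
open import Data.List.Properties using (length-map; length-filter; length-deduplicate)
open import Data.List.Membership.Propositional using (_∈_)
open import Data.List.Membership.Propositional.Properties
  using (∈-filter⁺; ∈-filter⁻; ∈-map⁺; ∈-map⁻; ∈-++⁺ˡ; ∈-++⁺ʳ; ∈-deduplicate⁺; ∈-deduplicate⁻; ∈-cartesianProduct⁺)
open import Data.List.Membership.Propositional.Properties.WithK using (unique∧set⇒bag)
open import Data.List.Relation.Unary.Any using (here; there)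
open import Data.List.Relation.Unary.AllPairs using ([]; _∷_)
open import Data.List.Relation.Unary.Unique.Propositional using (Unique)
import Data.List.Relation.Unary.All as All
import Data.List.Relation.Unary.All.Properties as All
import Data.List.Relation.Unary.Unique.Propositional.Properties as Unique
import Data.List.Relation.Unary.Unique.DecPropositional.Properties as DecUnique
open import Data.List.Relation.Binary.BagAndSetEquality using (∼bag⇒↭)
open import Data.List.Relation.Binary.Permutation.Propositional.Properties using (↭-length)
open import Data.Product using (_×_; _,_; proj₁; proj₂)
open import Data.Empty using (⊥; ⊥-elim)
open import Function.Bundles using (mk⇔)
open import Relation.Nullary using (¬_; Dec; yes; no; ¬?)
open import Relation.Nullary.Decidable using (_×-dec_)
open import Relation.Binary.PropositionalEquality using (_≡_; _≢_; refl; sym; trans; cong; subst; module ≡-Reasoning)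

same-members⇒same-length : ∀ {a} {A : Set a} {xs ys : List A} → Unique xs → Unique ys →
  (∀ {x} → x ∈ xs → x ∈ ys) → (∀ {x} → x ∈ ys → x ∈ xs) → length xs ≡ length ys
same-members⇒same-length xs! ys! xs⊆ys ys⊆xs =
  ↭-length (∼bag⇒↭ (unique∧set⇒bag xs! ys! (mk⇔ xs⊆ys ys⊆xs)))

unique-map⁺ : ∀ {a b} {A : Set a} {B : Set b} (f : A → B) {xs : List A} →
  (∀ {x y} → x ∈ xs → y ∈ xs → f x ≡ f y → x ≡ y) → Unique xs → Unique (map f xs)
unique-map⁺ f injective [] = []
unique-map⁺ f injective (x∉xs ∷ xs!) =
  All.map⁺ (All.tabulate λ y∈xs fx≡fy → All.lookup x∉xs y∈xs (injective (here refl) (there y∈xs) fx≡fy))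
  ∷ unique-map⁺ f (λ x∈ y∈ → injective (there x∈) (there y∈)) xs!

length-filter-split : ∀ {a} {A : Set a} {P Q : A → Set} (P? : ∀ x → Dec (P x)) (Q? : ∀ x → Dec (Q x)) →
  (∀ {x} → Q x → P x) → ∀ xs →
  length (filter P? xs) ≡ length (filter Q? xs) + length (filter (λ x → ¬? (Q? x) ×-dec P? x) xs)
length-filter-split P? Q? Q⇒P [] = refl
length-filter-split P? Q? Q⇒P (x ∷ xs) with Q? x | P? x
... | yes q | yes _ = cong suc (length-filter-split P? Q? Q⇒P xs)
... | yes q | no ¬p = ⊥-elim (¬p (Q⇒P q))
... | no _  | yes _ = trans (cong suc (length-filter-split P? Q? Q⇒P xs)) (sym (+-suc _ _))
... | no _  | no _  = length-filter-split P? Q? Q⇒P xs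

allSubsets-complete : ∀ n (S : Subset n) → S ∈ allSubsets n
allSubsets-complete zero    []      = here refl
allSubsets-complete (suc n) (true  ∷ S) = ∈-++⁺ˡ (∈-map⁺ (true ∷_) (allSubsets-complete n S))
allSubsets-complete (suc n) (false ∷ S) = ∈-++⁺ʳ _ (∈-map⁺ (false ∷_) (allSubsets-complete n S))

allSubsets-unique : ∀ n → Unique (allSubsets n)
allSubsets-unique zero = All.[] ∷ []
allSubsets-unique (suc n) =
  Unique.++⁺ (Unique.map⁺ ∷-injectiveʳ (allSubsets-unique n))
             (Unique.map⁺ ∷-injectiveʳ (allSubsets-unique n))
             heads-differ
  where
  heads-differ : ∀ {S} → S ∈ map (true ∷_) (allSubsets n) × S ∈ map (false ∷_) (allSubsets n) → ⊥
  heads-differ (p , q) with ∈-map⁻ (true ∷_) p | ∈-map⁻ (false ∷_) q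
  ... | _ , _ , refl | _ , _ , ()

allFin-sound : ∀ {n} (p : Fin n → Bool) → allFin p ≡ true → ∀ i → p i ≡ true
allFin-sound p all zero    = ∧-conicalˡ (p zero) _ all
allFin-sound p all (suc i) = allFin-sound (λ i → p (suc i)) (∧-conicalʳ (p zero) _ all) i

allFin-complete : ∀ {n} (p : Fin n → Bool) → (∀ i → p i ≡ true) → allFin p ≡ true
allFin-complete {zero}  p all = refl
allFin-complete {suc n} p all with p zero | all zero
... | true | _ = allFin-complete (λ i → p (suc i)) (λ i → all (suc i))

implies⁻ : ∀ {x y} → not x ∨ y ≡ true → x ≡ true → y ≡ true
implies⁻ {true} x⇒y refl = x⇒y

implies⁺ : ∀ {x y} → (x ≡ true → y ≡ true) → not x ∨ y ≡ true
implies⁺ {false} x⇒y = refl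
implies⁺ {true}  x⇒y = x⇒y refl

lookup⇒∈ : ∀ {n} {S : Subset n} {g} → lookup S g ≡ true → g ∈ˢ S
lookup⇒∈ {S = S} {g} = lookup⇒[]= g S

∈-tabulate⁺ : ∀ {n} (f : Fin n → Bool) {g} → f g ≡ true → g ∈ˢ tabulate f
∈-tabulate⁺ f {g} fg = lookup⇒∈ (trans (lookup∘tabulate f g) fg)

∈-tabulate⁻ : ∀ {n} (f : Fin n → Bool) {g} → g ∈ˢ tabulate f → f g ≡ true
∈-tabulate⁻ f {g} g∈ = trans (sym (lookup∘tabulate f g)) ([]=⇒lookup g∈)

module _ {n m} (K : Context n m) where

  HasAll : Fin n → Subset m → Set
  HasAll g B = ∀ {j} → j ∈ˢ B → K g j ≡ true

  SharedBy : Fin m → Subset n → Set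
  SharedBy j A = ∀ {g} → g ∈ˢ A → K g j ≡ true

  ∈-down⁺ : ∀ {B g} → HasAll g B → g ∈ˢ down K B
  ∈-down⁺ {B} has = ∈-tabulate⁺ (λ g → allFin λ j → not (lookup B j) ∨ K g j)
    (allFin-complete _ λ j → implies⁺ λ j∈B → has {j} (lookup⇒∈ j∈B))

  ∈-down⁻ : ∀ {B g} → g ∈ˢ down K B → HasAll g B
  ∈-down⁻ g∈ {j} j∈B = implies⁻ (allFin-sound _ (∈-tabulate⁻ _ g∈) j) ([]=⇒lookup j∈B)

  ∈-up⁺ : ∀ {A j} → SharedBy j A → j ∈ˢ up K A
  ∈-up⁺ {A} shared = ∈-tabulate⁺ (λ j → allFin λ g → not (lookup A g) ∨ K g j)
    (allFin-complete _ λ g → implies⁺ λ g∈A → shared {g} (lookup⇒∈ g∈A))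

  ∈-up⁻ : ∀ {A j} → j ∈ˢ up K A → SharedBy j A
  ∈-up⁻ j∈ {g} g∈A = implies⁻ (allFin-sound _ (∈-tabulate⁻ _ j∈) g) ([]=⇒lookup g∈A)

  closure : Subset n → Subset n
  closure S = down K (up K S)

  ∈-closure⁺ : ∀ {S g} → (∀ {j} → SharedBy j S → K g j ≡ true) → g ∈ˢ closure S
  ∈-closure⁺ k = ∈-down⁺ λ j∈ → k (∈-up⁻ j∈)

  ∈-closure⁻ : ∀ {S g} → g ∈ˢ closure S → ∀ {j} → SharedBy j S → K g j ≡ true
  ∈-closure⁻ g∈ shared = ∈-down⁻ g∈ (∈-up⁺ shared)

  closure-extensive : ∀ {S} → S ⊆ closure S
  closure-extensive g∈S = ∈-closure⁺ λ shared → shared g∈S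

  closure-mono : ∀ {S T} → S ⊆ T → closure S ⊆ closure T
  closure-mono S⊆T g∈ = ∈-closure⁺ λ shared → ∈-closure⁻ g∈ λ h∈S → shared (S⊆T h∈S)

  extent⁺ : ∀ {S} → closure S ⊆ S → IsExtent K S
  extent⁺ closure⊆ = ⊆-antisym closure⊆ closure-extensive

  extent⁻ : ∀ {S} → IsExtent K S → closure S ⊆ S
  extent⁻ {S} S-extent {g} g∈ = subst (g ∈ˢ_) S-extent g∈

  closure-extent : ∀ S → IsExtent K (closure S)
  closure-extent S = extent⁺ λ g∈ → ∈-closure⁺ λ {j} shared →
    ∈-closure⁻ {closure S} g∈ {j} λ h∈ → ∈-closure⁻ {S} h∈ shared

module _ {n m} (K : Context n m) (a' : Subset n) where

  private
    Kₐ : Context n (suc m)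
    Kₐ = extend K a'

  -- g ∈ S''ₐ  iff  g ∈ S'' and (S ⊆ a' → g ∈ a'): the new attribute a (index
  -- zero) is shared by S exactly when S ⊆ a'.
  ∈-closureₐ⁺ : ∀ {S g} → (S ⊆ a' → g ∈ˢ a') → g ∈ˢ closure K S → g ∈ˢ closure Kₐ S
  ∈-closureₐ⁺ {S} {g} S⊆a'⇒g∈a' g∈S'' = ∈-closure⁺ Kₐ {S} λ {j} → has {j}
    where
    has : ∀ {j} → SharedBy Kₐ j S → Kₐ g j ≡ true
    has {zero}  shared = []=⇒lookup (S⊆a'⇒g∈a' λ h∈S → lookup⇒∈ (shared h∈S))
    has {suc j} shared = ∈-closure⁻ K g∈S'' shared

  ∈-closureₐ⁻ : ∀ {S g} → g ∈ˢ closure Kₐ S → (S ⊆ a' → g ∈ˢ a') × g ∈ˢ closure K S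
  ∈-closureₐ⁻ {S} g∈ =
      (λ S⊆a' → lookup⇒∈ (∈-closure⁻ Kₐ {S} g∈ {zero} λ h∈S → []=⇒lookup (S⊆a' h∈S)))
    , ∈-closure⁺ K λ {j} shared → ∈-closure⁻ Kₐ {S} g∈ {suc j} shared

  extent⇒extentₐ : ∀ {S} → IsExtent K S → IsExtent Kₐ S
  extent⇒extentₐ {S} S-extent = extent⁺ Kₐ λ g∈ → extent⁻ K S-extent (proj₂ (∈-closureₐ⁻ {S} g∈))

  ∩-extentₐ : ∀ {A} → IsExtent K A → IsExtent Kₐ (A ∩ a')
  ∩-extentₐ {A} A-extent = extent⁺ Kₐ λ g∈ →
    let (A∩a'⊆a'⇒g∈a' , g∈closure) = ∈-closureₐ⁻ g∈
    in x∈p∩q⁺ ( extent⁻ K A-extent (closure-mono K (p∩q⊆p A a') g∈closure)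
              , A∩a'⊆a'⇒g∈a' (p∩q⊆q A a'))

  -- A new extent of Kₐ lies inside a': otherwise its closures in K and in Kₐ
  -- would coincide, making it an extent of K.
  new-extent⊆a' : ∀ {S} → IsExtent Kₐ S → ¬ IsExtent K S → S ⊆ a'
  new-extent⊆a' {S} Sₐ-extent not-extent with S ⊆? a'
  ... | yes S⊆a' = S⊆a'
  ... | no S⊈a' = ⊥-elim (not-extent (extent⁺ K λ g∈ →
          extent⁻ Kₐ Sₐ-extent (∈-closureₐ⁺ (λ S⊆a' → ⊥-elim (S⊈a' S⊆a')) g∈)))

  new-extent-shape : ∀ {S} → IsExtent Kₐ S → ¬ IsExtent K S → S ≡ closure K S ∩ a'
  new-extent-shape {S} Sₐ-extent not-extent = ⊆-antisym
    (λ g∈S → x∈p∩q⁺ (closure-extensive K g∈S , new-extent⊆a' Sₐ-extent not-extent g∈S))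
    (λ g∈ → extent⁻ Kₐ Sₐ-extent
      (∈-closureₐ⁺ {S} (λ _ → p∩q⊆q (closure K S) a' g∈) (p∩q⊆p (closure K S) a' g∈)))

module _ {n m} (K : Context n m) where

  extent-of : ∀ {A} → A ∈ extents K → IsExtent K A
  extent-of A∈ = proj₂ (∈-filter⁻ (isExtent? K) {xs = allSubsets n} A∈)

  extent-in : ∀ {A} → IsExtent K A → A ∈ extents K
  extent-in {A} A-extent = ∈-filter⁺ (isExtent? K) (allSubsets-complete n A) A-extent

  extents-unique : Unique (extents K)
  extents-unique = Unique.filter⁺ (isExtent? K) (allSubsets-unique n)

  -- |𝔅(K)| = |Ext(K)|: the concepts are exactly the pairs (A , A') with A an extent.
  numConcepts≡numExtents : numConcepts K ≡ length (extents K)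
  numConcepts≡numExtents = begin
    numConcepts K                        ≡⟨ same-members⇒same-length concepts! image! concept⇒image image⇒concept ⟩
    length (map withIntent (extents K))  ≡⟨ length-map withIntent (extents K) ⟩
    length (extents K)                   ∎
    where
    open ≡-Reasoning
    withIntent : Subset n → Subset n × Subset m
    withIntent A = A , up K A

    concepts! : Unique (concepts K)
    concepts! = Unique.filter⁺ (isConcept? K)
      (Unique.cartesianProduct⁺ (allSubsets-unique n) (allSubsets-unique m))

    image! : Unique (map withIntent (extents K))
    image! = Unique.map⁺ (cong proj₁) extents-unique

    concept⇒image : ∀ {p} → p ∈ concepts K → p ∈ map withIntent (extents K)
    concept⇒image {A , B} p∈ with proj₂ (∈-filter⁻ (isConcept? K)
                                   {xs = cartesianProduct (allSubsets n) (allSubsets m)} p∈)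
    ... | refl , A-extent = ∈-map⁺ withIntent (extent-in A-extent)

    image⇒concept : ∀ {p} → p ∈ map withIntent (extents K) → p ∈ concepts K
    image⇒concept p∈ with ∈-map⁻ withIntent p∈
    ... | A , A∈ , refl = ∈-filter⁺ (isConcept? K)
      (∈-cartesianProduct⁺ (allSubsets-complete n A) (allSubsets-complete m (up K A)))
      (refl , extent-of A∈)

module _ {n m} (K : Context n m) (a' : Subset n) where

  private
    Kₐ : Context n (suc m)
    Kₐ = extend K a'

    traces : List (Subset n)
    traces = map (_∩ a') (extents K)

    nonExtent? : ∀ S → Dec (¬ IsExtent K S)
    nonExtent? S = ¬? (isExtent? K S)

    newExtent? : ∀ S → Dec (¬ IsExtent K S × IsExtent Kₐ S)
    newExtent? S = nonExtent? S ×-dec isExtent? Kₐ S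

    newExtents : List (Subset n)
    newExtents = filter newExtent? (allSubsets n)

  ∈-𝓗⁺ : ∀ {S} → S ∈ traces → ¬ IsExtent K S → S ∈ 𝓗 K a'
  ∈-𝓗⁺ S∈ not-extent = ∈-deduplicate⁺ _≟ˢ_ (∈-filter⁺ nonExtent? S∈ not-extent)

  ∈-𝓗⁻ : ∀ {S} → S ∈ 𝓗 K a' → S ∈ traces × ¬ IsExtent K S
  ∈-𝓗⁻ S∈ = ∈-filter⁻ nonExtent? {xs = traces} (∈-deduplicate⁻ _≟ˢ_ (filter nonExtent? traces) S∈)

  -- By (ii) and (iii), the extents of Kₐ that are not extents of K are
  -- exactly the members of 𝓗(a).
  numNewExtents≡h : length newExtents ≡ h K a'
  numNewExtents≡h = same-members⇒same-length
    (Unique.filter⁺ newExtent? (allSubsets-unique n))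
    (DecUnique.deduplicate-! _≟ˢ_ (filter nonExtent? traces))
    new⇒𝓗 𝓗⇒new
    where
    new⇒𝓗 : ∀ {S} → S ∈ newExtents → S ∈ 𝓗 K a'
    new⇒𝓗 {S} S∈ with proj₂ (∈-filter⁻ newExtent? {xs = allSubsets n} S∈)
    ... | not-extent , Sₐ-extent = ∈-𝓗⁺
      (subst (_∈ traces) (sym (new-extent-shape K a' Sₐ-extent not-extent))
        (∈-map⁺ (_∩ a') (extent-in K (closure-extent K S))))
      not-extent

    𝓗⇒new : ∀ {S} → S ∈ 𝓗 K a' → S ∈ newExtents
    𝓗⇒new {S} S∈ with ∈-𝓗⁻ S∈
    ... | S∈traces , not-extent with ∈-map⁻ (_∩ a') S∈traces
    ... | A , A∈ , refl = ∈-filter⁺ newExtent? (allSubsets-complete n S)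
      (not-extent , ∩-extentₐ K a' (extent-of K A∈))

  numExtents-extend : length (extents Kₐ) ≡ length (extents K) + h K a'
  numExtents-extend = begin
    length (extents Kₐ)                      ≡⟨ length-filter-split (isExtent? Kₐ) (isExtent? K)
                                                  (extent⇒extentₐ K a') (allSubsets n) ⟩
    length (extents K) + length newExtents   ≡⟨ cong (length (extents K) +_) numNewExtents≡h ⟩
    length (extents K) + h K a'              ∎
    where open ≡-Reasoning

  h≤numExtents : h K a' ≤ length (extents K)
  h≤numExtents = begin
    h K a'                              ≤⟨ length-deduplicate _≟ˢ_ (filter nonExtent? traces) ⟩
    length (filter nonExtent? traces)   ≤⟨ length-filter nonExtent? traces ⟩
    length traces                       ≡⟨ length-map (_∩ a') (extents K) ⟩
    length (extents K)                  ∎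
    where open ≤-Reasoning

  h≡numExtents : (∀ A → IsExtent K A → ¬ IsExtent K (A ∩ a')) →
    (∀ A₁ A₂ → IsExtent K A₁ → IsExtent K A₂ → A₁ ≢ A₂ → (A₁ ∩ a') ≢ (A₂ ∩ a')) →
    h K a' ≡ length (extents K)
  h≡numExtents no-trace-extent traces-distinct = begin
    h K a'           ≡⟨ same-members⇒same-length (DecUnique.deduplicate-! _≟ˢ_ (filter nonExtent? traces))
                          traces! (λ S∈ → proj₁ (∈-𝓗⁻ S∈)) trace⇒𝓗 ⟩
    length traces    ≡⟨ length-map (_∩ a') (extents K) ⟩
    length (extents K) ∎
    where
    open ≡-Reasoning
    ∩a'-injective : ∀ {A₁ A₂} → A₁ ∈ extents K → A₂ ∈ extents K → A₁ ∩ a' ≡ A₂ ∩ a' → A₁ ≡ A₂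
    ∩a'-injective {A₁} {A₂} A₁∈ A₂∈ same-trace with A₁ ≟ˢ A₂
    ... | yes A₁≡A₂ = A₁≡A₂
    ... | no A₁≢A₂  = ⊥-elim (traces-distinct A₁ A₂ (extent-of K A₁∈) (extent-of K A₂∈) A₁≢A₂ same-trace)

    traces! : Unique traces
    traces! = unique-map⁺ (_∩ a') ∩a'-injective (extents-unique K)

    trace⇒𝓗 : ∀ {S} → S ∈ traces → S ∈ 𝓗 K a'
    trace⇒𝓗 S∈ with ∈-map⁻ (_∩ a') S∈
    ... | A , A∈ , refl = ∈-𝓗⁺ S∈ (no-trace-extent A (extent-of K A∈))

proposition2 : ∀ {n m} (K : Context n m) (a' : Subset n) →
    (numConcepts (extend K a') ≡ numConcepts K + h K a' × h K a' ≤ numConcepts K)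
    × ((∀ A → IsExtent K A → ¬ IsExtent K (A ∩ a')) →
       (∀ A₁ A₂ → IsExtent K A₁ → IsExtent K A₂ → A₁ ≢ A₂ → (A₁ ∩ a') ≢ (A₂ ∩ a')) →
       h K a' ≡ numConcepts K)
proposition2 K a' =
    ( (begin
        numConcepts (extend K a')             ≡⟨ numConcepts≡numExtents (extend K a') ⟩
        length (extents (extend K a'))        ≡⟨ numExtents-extend K a' ⟩
        length (extents K) + h K a'           ≡⟨ cong (_+ h K a') (sym (numConcepts≡numExtents K)) ⟩
        numConcepts K + h K a'                ∎)
    , subst (h K a' ≤_) (sym (numConcepts≡numExtents K)) (h≤numExtents K a'))
  , λ no-trace-extent traces-distinct →
      trans (h≡numExtents K a' no-trace-extent traces-distinct) (sym (numConcepts≡numExtents K))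
  where open ≡-Reasoning
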